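{- Let $G$ be a connected simple graph with $n\ge3$ vertices and $2n-3$ edges, and let $c:E(G)\to[n-1]$ be a colouring with $|c^{ -1}(1)|=1$ and $|c^{ -1}(i)|=2$ for $i=2,\dots,n-1$, such that $G$ has no rainbow cycle. Then for all pairs of distinct vertices $u,v$ of $G$, $\mathrm{dist}^c_G(u,v)\le\lfloor n/2\rfloor$. Furthermore, when $n$ is even, there is at most one pair of vertices $u,v$ with $\mathrm{dist}^c_G(u,v)=n/2$.
   Context: A path or cycle is rainbow if its edges have pairwise distinct colours. $\mathrm{dist}^c_G(u,v)$ is the length (number of edges) of a shortest rainbow path between $u$ and $v$ in $G$, or $\infty$ if none exists. -}

module Defs where

open import Data.Nat using (ℕ; zero; suc; _≤_; _<_)
open import Data.Fin using (Fin)
open import Data.Product using (Σ; ∃; _×_; _,_; swap)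
open import Data.Sum using (_⊎_)
open import Data.List using (List; []; _∷_; length; map; filter; drop)
open import Data.List.Relation.Unary.Unique.Propositional using (Unique)
open import Data.Fin using (_≟_)
open import Data.Fin.Properties using () renaming (_≟_ to _≟ᶠ_)
open import Data.List using () renaming (allFin to allFinL)
open import Relation.Binary.PropositionalEquality using (_≡_; _≢_)
open import Relation.Nullary using (¬_)

module _ {n m : ℕ} (E : Fin m → Fin n × Fin n) where

  Joins : Fin m → Fin n → Fin n → Set
  Joins j u w = (E j ≡ (u , w)) ⊎ (E j ≡ (w , u))

  Simple : Set
  Simple = (∀ j u → ¬ Joins j u u)
         × (∀ i j u w → Joins i u w → Joins j u w → i ≡ j)

  data Walk : Fin n → Fin n → Set where
    []   : ∀ {u} → Walk u u
    step : ∀ {u w v} (j : Fin m) → Joins j u w → Walk w v → Walk u v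

  walkVerts : ∀ {u v} → Walk u v → List (Fin n)
  walkVerts {u} []             = u ∷ []
  walkVerts {u} (step j _ p)   = u ∷ walkVerts p

  walkEdges : ∀ {u v} → Walk u v → List (Fin m)
  walkEdges []           = []
  walkEdges (step j _ p) = j ∷ walkEdges p

  len : ∀ {u v} → Walk u v → ℕ
  len p = length (walkEdges p)

  Connected : Set
  Connected = ∀ u v → Walk u v

  module _ {k : ℕ} (c : Fin m → Fin k) where

    Rainbow : ∀ {u v} → Walk u v → Set
    Rainbow p = Unique (map c (walkEdges p))

    IsPath : ∀ {u v} → Walk u v → Set
    IsPath p = Unique (walkVerts p)

    RainbowPath : Fin n → Fin n → Set
    RainbowPath u v = Σ (Walk u v) λ p → IsPath p × Rainbow p

    -- a rainbow cycle: closed walk of length ≥ 3, vertices distinct apart from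
    -- start = end, edge colours pairwise distinct (hence edges distinct)
    HasRainbowCycle : Set
    HasRainbowCycle = Σ (Fin n) λ u → Σ (Walk u u) λ p →
      (3 ≤ len p) × Unique (drop 1 (walkVerts p)) × Rainbow p

    RainbowDist : Fin n → Fin n → ℕ → Set
    RainbowDist u v d = (Σ (RainbowPath u v) λ q → len (Data.Product.proj₁ q) ≡ d)
                      × (∀ (q : RainbowPath u v) → d ≤ len (Data.Product.proj₁ q))

    classSize : Fin k → ℕ
    classSize i = length (filter (λ j → c j ≟ᶠ i) (allFinL m))

{-# OPTIONS --safe #-}

-- A vertex owns a colour if it is an endpoint of every edge of that colour. Without rainbow
-- cycles every vertex owns a colour, and choosing one for each vertex gives a bijection from the
-- vertices other than the two ends a, b of the edge of colour 1 onto the colours other than 1.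
--
-- Call a vertex set A admissible if it contains a and b and, with each inner vertex, the other
-- ends of the edges of the colour it owns. An admissible A with |A| ≥ 3 has an inner vertex x
-- all of whose edges into A have its own colour. Then A − x is admissible, rainbow distances in
-- A between vertices other than x are the same as in A − x, and d(x, v) = 1 + min(d(y₁, v),
-- d(y₂, v)), where y₁ ≠ y₂ are the other ends of the two edges of x's colour. Removing such
-- vertices down to {a, b} gives, by induction on t: if |A| = 2t + 2, all rainbow distances in A
-- are at most t + 1 and at most one pair is at distance t + 1; if |A| = 2t + 3, all are at most
-- t + 1, and two distinct vertices are both at distance t + 1 from at most one common vertex.

module Submission where

open import Defs
open import Data.Empty using (⊥-elim)
open import Data.Fin using (Fin; zero; toℕ; fromℕ<)
open import Data.Fin.Properties as Fin using (toℕ<n; toℕ-fromℕ<; toℕ-injective; pigeonhole)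
open import Data.List using (List; []; _∷_; length; map; filter; reverse; applyUpTo; _∷ʳ_; drop; allFin)
open import Data.List.Membership.Propositional using (_∈_; find; lose)
open import Data.List.Membership.Propositional.Properties
  using (∈-length; ∈-filter⁺; ∈-filter⁻; ∈-allFin; ∈-map⁺; ∈-map⁻)
open import Data.List.Properties
  using ( length-map; length-tabulate; length-applyUpTo; length-reverse; map-applyUpTo; reverse-map
        ; unfold-reverse; filter-all; filter-notAll; filter-accept; filter-reject )
open import Data.List.Relation.Binary.Permutation.Propositional using (↭-sym; ↭⇒↭ₛ)
open import Data.List.Relation.Binary.Permutation.Propositional.Properties using (↭-reverse; All-resp-↭)
open import Data.List.Relation.Unary.All as All using (All; []; _∷_)
open import Data.List.Relation.Unary.All.Properties as All using ()
open import Data.List.Relation.Unary.AllPairs using ([]; _∷_)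
open import Data.List.Relation.Unary.Any as Any using (Any; here; there)
open import Data.List.Relation.Unary.Unique.Propositional using (Unique)
open import Data.List.Relation.Unary.Unique.Propositional.Properties using (filter⁺; map⁺; applyUpTo⁺₁; allFin⁺)
open import Data.Nat using (ℕ; zero; suc; _+_; _*_; _∸_; _≤_; _<_; _⊓_; z≤n; s≤s)
open import Data.Nat.DivMod using (_/_; +-distrib-/-∣ʳ; m*n/n≡m; [m+kn]%n≡m%n)
open import Data.Nat.Divisibility using (_∣_; divides; n∣m⇒m%n≡0)
open import Data.Nat.Induction using (<-wellFounded)
open import Data.Nat.Properties as ℕ using ()
open import Data.Product using (Σ; ∃; ∃₂; _×_; _,_; proj₁; proj₂; uncurry)
open import Data.Product.Properties using (≡-dec)
open import Data.Sum using (_⊎_; inj₁; inj₂; [_,_]′)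
open import Function using (_∘_; id; flip)
open import Induction.WellFounded using (Acc; acc)
open import Relation.Binary.Definitions using (DecidableEquality)
open import Relation.Binary.PropositionalEquality
  using (_≡_; _≢_; refl; sym; trans; cong; cong₂; subst; ≢-sym; setoid; module ≡-Reasoning)
open import Relation.Nullary using (¬_; Dec; yes; no; ¬?)
open import Relation.Nullary.Decidable using (_⊎-dec_; _×-dec_; _→-dec_; decidable-stable)

module Remove {X : Set} (_≟_ : DecidableEquality X) where

  open import Data.List.Membership.DecPropositional _≟_ using (_∈?_)

  _≢?_ : ∀ y x → Dec (y ≢ x)
  y ≢? x = ¬? (y ≟ x)

  remove : X → List X → List X
  remove x = filter (_≢? x)

  module _ {x : X} where

    ∈-remove⁺ : ∀ {y xs} → y ∈ xs → y ≢ x → y ∈ remove x xs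
    ∈-remove⁺ = ∈-filter⁺ (_≢? x)

    ∈-remove⁻ : ∀ {y} xs → y ∈ remove x xs → y ∈ xs × y ≢ x
    ∈-remove⁻ xs = ∈-filter⁻ (_≢? x) {xs = xs}

    remove⁺ : ∀ {xs} → Unique xs → Unique (remove x xs)
    remove⁺ = filter⁺ (_≢? x)

    length-remove : ∀ {xs} → Unique xs → x ∈ xs → length xs ≡ suc (length (remove x xs))
    length-remove {x ∷ ys} (x∉ys ∷ _) (here refl) = cong suc (begin
      length ys                  ≡⟨ cong length (filter-all (_≢? x) (All.map ≢-sym x∉ys)) ⟨
      length (remove x ys)       ≡⟨ cong length (filter-reject (_≢? x) (λ x≢x → x≢x refl)) ⟨
      length (remove x (x ∷ ys)) ∎)
      where open ≡-Reasoning
    length-remove {y ∷ ys} (y∉ys ∷ u) (there x∈ys) = begin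
      suc (length ys)                  ≡⟨ cong suc (length-remove u x∈ys) ⟩
      suc (suc (length (remove x ys))) ≡⟨ cong (suc ∘ length) (filter-accept (_≢? x) (All.lookup y∉ys x∈ys)) ⟨
      suc (length (remove x (y ∷ ys))) ∎
      where open ≡-Reasoning

    length-remove< : ∀ {xs} → x ∈ xs → length (remove x xs) < length xs
    length-remove< x∈xs = filter-notAll (_≢? x) _ (Any.map (λ x≡y y≢x → y≢x (sym x≡y)) x∈xs)

    length-remove≤ : ∀ {xs} → Unique xs → length xs ≤ suc (length (remove x xs))
    length-remove≤ {xs} u with x ∈? xs
    ... | yes x∈xs = ℕ.≤-reflexive (length-remove u x∈xs)
    ... | no  x∉xs = ℕ.m≤n⇒m≤1+n (ℕ.≤-reflexive (sym (cong length (filter-all (_≢? x) x∉xs′))))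
      where
      x∉xs′ : All (_≢ x) xs
      x∉xs′ = All.tabulate λ y∈xs y≡x → x∉xs (subst (_∈ xs) y≡x y∈xs)

module _ {N : ℕ} where
  open Remove (Fin._≟_ {N}) public

module _ {A : Set} where

  open import Data.List.Relation.Binary.Permutation.Setoid.Properties (setoid A) using (Unique-resp-↭)

  Unique-reverse : ∀ {xs : List A} → Unique xs → Unique (reverse xs)
  Unique-reverse {xs} = Unique-resp-↭ (↭⇒↭ₛ (↭-sym (↭-reverse xs)))

  All-reverse : ∀ {P : A → Set} {xs : List A} → All P xs → All P (reverse xs)
  All-reverse {xs = xs} = All-resp-↭ (↭-sym (↭-reverse xs))

SamePair : {A : Set} → A → A → A → A → Set
SamePair u v u′ v′ = (u ≡ u′ × v ≡ v′) ⊎ (u ≡ v′ × v ≡ u′)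

module _ {A : Set} {u v u′ v′ : A} where

  samePair-sym : SamePair u v u′ v′ → SamePair u′ v′ u v
  samePair-sym (inj₁ (refl , refl)) = inj₁ (refl , refl)
  samePair-sym (inj₂ (refl , refl)) = inj₂ (refl , refl)

  samePair-trans : ∀ {u″ v″} → SamePair u v u′ v′ → SamePair u′ v′ u″ v″ → SamePair u v u″ v″
  samePair-trans (inj₁ (refl , refl)) q                    = q
  samePair-trans (inj₂ (refl , refl)) (inj₁ (refl , refl)) = inj₂ (refl , refl)
  samePair-trans (inj₂ (refl , refl)) (inj₂ (refl , refl)) = inj₁ (refl , refl)

samePair-common : ∀ {A : Set} {u v u′ : A} → SamePair u v u′ v → u ≡ u′
samePair-common (inj₁ (u≡u′ , _))   = u≡u′
samePair-common (inj₂ (u≡v , v≡u′)) = trans u≡v v≡u′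

DistinctUpTo : {A : Set} → (ℕ → A) → ℕ → Set
DistinctUpTo f k = ∀ {i j} → i < j → j < k → f i ≢ f j

distinct-rotate : ∀ {A : Set} {f : ℕ → A} {l} → f l ≡ f 0 → DistinctUpTo f l → DistinctUpTo (f ∘ suc) l
distinct-rotate closed distinct {i} i<j j<l with ℕ.m≤n⇒m<n∨m≡n j<l
... | inj₁ 1+j<l = distinct (s≤s i<j) 1+j<l
... | inj₂ refl  = λ same → distinct (s≤s z≤n) (s≤s i<j) (sym (trans same closed))

module _ {n : ℕ} (f : ℕ → Fin n) where

  FirstRepetition : Set
  FirstRepetition = ∃₂ λ i k → 0 < k × f (k + i) ≡ f i × DistinctUpTo (λ t → f (t + i)) k

  private
    repetition-or-distinct : ∀ J → FirstRepetition ⊎ DistinctUpTo f J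
    repetition-or-distinct zero = inj₂ λ _ ()
    repetition-or-distinct (suc J) with repetition-or-distinct J
    ... | inj₁ r = inj₁ r
    ... | inj₂ distinct with Fin.any? {n = J} (λ s → f (toℕ s) Fin.≟ f J)
    ... | yes (s , fs≡fJ) = inj₁ (toℕ s , J ∸ toℕ s , ℕ.m<n⇒0<n∸m (toℕ<n s) ,
                                  trans (cong f J∸s+s≡J) (sym fs≡fJ) , shifted)
      where
      J∸s+s≡J : J ∸ toℕ s + toℕ s ≡ J
      J∸s+s≡J = ℕ.m∸n+n≡m (ℕ.<⇒≤ (toℕ<n s))
      shifted : DistinctUpTo (λ t → f (t + toℕ s)) (J ∸ toℕ s)
      shifted {j = j} i<j j<k = distinct (ℕ.+-monoˡ-< (toℕ s) i<j)
                                         (subst (j + toℕ s <_) J∸s+s≡J (ℕ.+-monoˡ-< (toℕ s) j<k))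
    ... | no ¬collision = inj₂ extended
      where
      extended : DistinctUpTo f (suc J)
      extended {i} i<j j<1+J with ℕ.m≤n⇒m<n∨m≡n (ℕ.≤-pred j<1+J)
      ... | inj₁ j<J  = distinct i<j j<J
      ... | inj₂ refl = λ fi≡fJ → ¬collision (fromℕ< i<j , trans (cong f (toℕ-fromℕ< i<j)) fi≡fJ)

  firstRepetition : FirstRepetition
  firstRepetition with repetition-or-distinct (suc n)
  ... | inj₁ r        = r
  ... | inj₂ distinct with pigeonhole (ℕ.n<1+n n) (f ∘ toℕ)
  ... | i , j , i<j , fi≡fj = ⊥-elim (distinct i<j (toℕ<n j) fi≡fj)

module _ {n m : ℕ} (E : Fin m → Fin n × Fin n) where

  Joins-sym : ∀ {g u w} → Joins E g u w → Joins E g w u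
  Joins-sym (inj₁ e) = inj₂ e
  Joins-sym (inj₂ e) = inj₁ e

  Joins-samePair : ∀ {g u w u′ w′} → Joins E g u w → Joins E g u′ w′ → SamePair u w u′ w′
  Joins-samePair (inj₁ refl) (inj₁ refl) = inj₁ (refl , refl)
  Joins-samePair (inj₁ refl) (inj₂ refl) = inj₂ (refl , refl)
  Joins-samePair (inj₂ refl) (inj₁ refl) = inj₂ (refl , refl)
  Joins-samePair (inj₂ refl) (inj₂ refl) = inj₁ (refl , refl)

  Joins-functional : ∀ {g u w w′} → Joins E g u w → Joins E g u w′ → w ≡ w′
  Joins-functional J J′ with Joins-samePair J J′
  ... | inj₁ (_ , w≡w′)   = w≡w′
  ... | inj₂ (u≡w′ , w≡u) = trans w≡u u≡w′

  joins? : ∀ g u w → Dec (Joins E g u w)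
  joins? g u w = ≡-dec Fin._≟_ Fin._≟_ (E g) (u , w) ⊎-dec ≡-dec Fin._≟_ Fin._≟_ (E g) (w , u)

  Incident : Fin n → Fin m → Set
  Incident x g = ∃ (Joins E g x)

  incident? : ∀ x g → Dec (Incident x g)
  incident? x g = Fin.any? (joins? g x)

  Incident-endpoint : ∀ {g u w x} → Joins E g u w → Incident x g → x ≡ u ⊎ x ≡ w
  Incident-endpoint J (_ , J′) with Joins-samePair J J′
  ... | inj₁ (u≡x , _) = inj₁ (sym u≡x)
  ... | inj₂ (_ , w≡x) = inj₂ (sym w≡x)

  Incident⇒Joins : ∀ {g x y} → Incident x g → Incident y g → x ≢ y → Joins E g x y
  Incident⇒Joins (w , J) y∈g x≢y with Incident-endpoint J y∈g
  ... | inj₁ y≡x = ⊥-elim (x≢y (sym y≡x))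
  ... | inj₂ refl = J

  EndpointsIn : List (Fin n) → Fin m → Set
  EndpointsIn B g = ∀ {x} → Incident x g → x ∈ B

  source∈walkVerts : ∀ {u v} (p : Walk E u v) → u ∈ walkVerts E p
  source∈walkVerts []           = here refl
  source∈walkVerts (step _ _ _) = here refl

  target∈walkVerts : ∀ {u v} (p : Walk E u v) → v ∈ walkVerts E p
  target∈walkVerts []           = here refl
  target∈walkVerts (step _ _ p) = there (target∈walkVerts p)

  record InfWalk : Set where
    field
      vertex : ℕ → Fin n
      edge   : ℕ → Fin m
      joins  : ∀ t → Joins E (edge t) (vertex t) (vertex (suc t))

  open InfWalk

  tail : InfWalk → InfWalk
  tail W = record { vertex = vertex W ∘ suc ; edge = edge W ∘ suc ; joins = joins W ∘ suc }

  shift : ℕ → InfWalk → InfWalk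
  shift i W = record
    { vertex = λ t → vertex W (t + i) ; edge = λ t → edge W (t + i) ; joins = λ t → joins W (t + i) }

  prefix : ∀ (W : InfWalk) k {v} → vertex W k ≡ v → Walk E (vertex W 0) v
  prefix W zero    refl = []
  prefix W (suc k) eq   = step (edge W 0) (joins W 0) (prefix (tail W) k eq)

  walkVerts-prefix : ∀ W k {v} (eq : vertex W k ≡ v) →
                     walkVerts E (prefix W k eq) ≡ applyUpTo (vertex W) (suc k)
  walkVerts-prefix W zero    refl = refl
  walkVerts-prefix W (suc k) eq   = cong (vertex W 0 ∷_) (walkVerts-prefix (tail W) k eq)

  walkEdges-prefix : ∀ W k {v} (eq : vertex W k ≡ v) →
                     walkEdges E (prefix W k eq) ≡ applyUpTo (edge W) k
  walkEdges-prefix W zero    refl = refl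
  walkEdges-prefix W (suc k) eq   = cong (edge W 0 ∷_) (walkEdges-prefix (tail W) k eq)

  module Unfold {S : Set} (position : S → Fin n) (next : S → S) (via : S → Fin m)
                (moves : ∀ s → Joins E (via s) (position s) (position (next s))) where

    orbit : S → ℕ → S
    orbit s zero    = s
    orbit s (suc t) = next (orbit s t)

    unfold : S → InfWalk
    unfold s = record { vertex = position ∘ orbit s ; edge = via ∘ orbit s ; joins = moves ∘ orbit s }

  _▷_ : ∀ {u v w g} → Walk E u v → Joins E g v w → Walk E u w
  _▷_ {g = g} []   J = step g J []
  step h J′ p ▷ J   = step h J′ (p ▷ J)

  walkVerts-▷ : ∀ {u v w g} (p : Walk E u v) (J : Joins E g v w) →
                walkVerts E (p ▷ J) ≡ walkVerts E p ∷ʳ w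
  walkVerts-▷ []               J = refl
  walkVerts-▷ {u} (step _ _ p) J = cong (u ∷_) (walkVerts-▷ p J)

  walkEdges-▷ : ∀ {u v w g} (p : Walk E u v) (J : Joins E g v w) →
                walkEdges E (p ▷ J) ≡ walkEdges E p ∷ʳ g
  walkEdges-▷ []           J = refl
  walkEdges-▷ (step h _ p) J = cong (h ∷_) (walkEdges-▷ p J)

  reverseWalk : ∀ {u v} → Walk E u v → Walk E v u
  reverseWalk []           = []
  reverseWalk (step g J p) = reverseWalk p ▷ Joins-sym J

  walkVerts-reverse : ∀ {u v} (p : Walk E u v) → walkVerts E (reverseWalk p) ≡ reverse (walkVerts E p)
  walkVerts-reverse []               = refl
  walkVerts-reverse {u} (step g J p) = begin
    walkVerts E (reverseWalk p ▷ Joins-sym J) ≡⟨ walkVerts-▷ (reverseWalk p) (Joins-sym J) ⟩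
    walkVerts E (reverseWalk p) ∷ʳ u          ≡⟨ cong (_∷ʳ u) (walkVerts-reverse p) ⟩
    reverse (walkVerts E p) ∷ʳ u              ≡⟨ unfold-reverse u (walkVerts E p) ⟨
    reverse (u ∷ walkVerts E p)               ∎
    where open ≡-Reasoning

  walkEdges-reverse : ∀ {u v} (p : Walk E u v) → walkEdges E (reverseWalk p) ≡ reverse (walkEdges E p)
  walkEdges-reverse []           = refl
  walkEdges-reverse (step g J p) = begin
    walkEdges E (reverseWalk p ▷ Joins-sym J) ≡⟨ walkEdges-▷ (reverseWalk p) (Joins-sym J) ⟩
    walkEdges E (reverseWalk p) ∷ʳ g          ≡⟨ cong (_∷ʳ g) (walkEdges-reverse p) ⟩
    reverse (walkEdges E p) ∷ʳ g              ≡⟨ unfold-reverse g (walkEdges E p) ⟨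
    reverse (g ∷ walkEdges E p)               ∎
    where open ≡-Reasoning

-- Rainbow cycles

ColourInjectiveOn : ∀ {m k} → (Fin m → Fin k) → List (Fin m) → Set
ColourInjectiveOn c L = ∀ {g h} → g ∈ L → h ∈ L → c g ≡ c h → g ≡ h

module _ {n m k : ℕ} {E : Fin m → Fin n × Fin n} (c : Fin m → Fin k) where

  open InfWalk

  closedPrefix⇒rainbowCycle : ∀ (W : InfWalk E) {l} → 3 ≤ l → (closed : vertex W l ≡ vertex W 0) →
                              DistinctUpTo (vertex W ∘ suc) l → DistinctUpTo (c ∘ edge W) l →
                              HasRainbowCycle E c
  closedPrefix⇒rainbowCycle W {l} 3≤l closed distinctVertices distinctColours =
    vertex W 0 , cycle , long , cycleUnique , rainbow
    where
    cycle : Walk E (vertex W 0) (vertex W 0)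
    cycle = prefix E W l closed
    edges≡ : walkEdges E cycle ≡ applyUpTo (edge W) l
    edges≡ = walkEdges-prefix E W l closed
    long : 3 ≤ len E cycle
    long = subst (3 ≤_) (sym (trans (cong length edges≡) (length-applyUpTo (edge W) l))) 3≤l
    cycleUnique : Unique (drop 1 (walkVerts E cycle))
    cycleUnique = subst (Unique ∘ drop 1) (sym (walkVerts-prefix E W l closed))
                        (applyUpTo⁺₁ (vertex W ∘ suc) l distinctVertices)
    rainbow : Rainbow E c cycle
    rainbow = subst Unique (sym (trans (cong (map c) edges≡) (map-applyUpTo (edge W) c l)))
                    (applyUpTo⁺₁ (c ∘ edge W) l distinctColours)

  module _ (simple : Simple E) where

    private
      noLoop : ∀ g u → ¬ Joins E g u u
      noLoop = proj₁ simple

      parallel : ∀ g h u w → Joins E g u w → Joins E h u w → g ≡ h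
      parallel = proj₂ simple

    NonBacktracking : InfWalk E → Set
    NonBacktracking W = ∀ t → edge W (suc t) ≢ edge W t

    ColourRepeatsEdgeOrHead : InfWalk E → Set
    ColourRepeatsEdgeOrHead W = ∀ s t → c (edge W s) ≡ c (edge W t) →
                                edge W s ≡ edge W t ⊎ vertex W (suc s) ≡ vertex W (suc t)

    firstReturn⇒rainbowCycle : ∀ (W : InfWalk E) {l} → 0 < l → vertex W l ≡ vertex W 0 →
                               DistinctUpTo (vertex W) l → NonBacktracking W →
                               ColourRepeatsEdgeOrHead W → HasRainbowCycle E c
    firstReturn⇒rainbowCycle W {1} _ closed _ _ _ =
      ⊥-elim (noLoop (edge W 0) (vertex W 0) (subst (Joins E (edge W 0) (vertex W 0)) closed (joins W 0)))
    firstReturn⇒rainbowCycle W {2} _ closed _ nb _ =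
      ⊥-elim (nb 0 (parallel _ _ _ _ (Joins-sym E (subst (Joins E (edge W 1) (vertex W 1)) closed (joins W 1)))
                                     (joins W 0)))
    firstReturn⇒rainbowCycle W {l@(suc (suc (suc _)))} _ closed distinct nb colour =
      closedPrefix⇒rainbowCycle W (s≤s (s≤s (s≤s z≤n))) closed distinct′ distinctColours
      where
      distinct′ : DistinctUpTo (vertex W ∘ suc) l
      distinct′ = distinct-rotate closed distinct
      distinctColours : DistinctUpTo (c ∘ edge W) l
      distinctColours {i} {j} i<j j<l sameColour with colour i j sameColour
      ... | inj₂ sameHead = distinct′ i<j j<l sameHead
      ... | inj₁ sameEdge
            with Joins-samePair E (joins W i) (subst (λ g → Joins E g _ _) (sym sameEdge) (joins W j))
      ...   | inj₁ (sameTail , _) = distinct i<j j<l sameTail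
      ...   | inj₂ (_ , crossed) with ℕ.m≤n⇒m<n∨m≡n i<j
      ...     | inj₁ 1+i<j = distinct 1+i<j j<l crossed
      ...     | inj₂ refl  = nb i (sym sameEdge)

    nonBacktracking⇒rainbowCycle : ∀ (W : InfWalk E) → NonBacktracking W → ColourRepeatsEdgeOrHead W →
                                   HasRainbowCycle E c
    nonBacktracking⇒rainbowCycle W nb colour with firstRepetition (vertex W)
    ... | i , l , 0<l , closed , distinct =
      firstReturn⇒rainbowCycle (shift E i W) 0<l closed distinct (nb ∘ (_+ i)) (λ s t → colour (s + i) (t + i))

    private
      LeavesAt : List (Fin m) → Fin n → Fin m → Set
      LeavesAt L v g = Any (λ h → Incident E v h × h ≢ g) L

      leaves? : ∀ L v g → Dec (LeavesAt L v g)
      leaves? L v g = Any.any? (λ h → incident? E v h ×-dec ¬? (h Fin.≟ g)) L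

      leaf-or-branching : ∀ (B : List (Fin n)) L →
                          (∃₂ λ v g → v ∈ B × ¬ LeavesAt L v g) ⊎ (∀ {v} → v ∈ B → ∀ g → LeavesAt L v g)
      leaf-or-branching B L with Any.any? (λ v → Fin.any? (λ g → ¬? (leaves? L v g))) B
      ... | yes leaf = let v , v∈B , g , stuck = find leaf in inj₁ (v , g , v∈B , stuck)
      ... | no ¬leaf = inj₂ λ {v} v∈B g →
                         decidable-stable (leaves? L v g) (λ stuck → ¬leaf (lose v∈B (g , stuck)))

      branching⇒rainbowCycle : ∀ {B L} → ColourInjectiveOn c L → All (EndpointsIn E B) L →
                               (∀ {v} → v ∈ B → ∀ g → LeavesAt L v g) → ∀ {g₀} → g₀ ∈ L →
                               HasRainbowCycle E c
      branching⇒rainbowCycle {B} {L} injective endpoints branching {g₀} g₀∈L =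
        nonBacktracking⇒rainbowCycle (unfold start) (turns ∘ orbit start) colours
        where
        State : Set
        State = Σ (Fin n) λ v → ∃ λ g → g ∈ L × Incident E v g

        leave : (s : State) → ∃ λ h → h ∈ L × Incident E (proj₁ s) h × h ≢ proj₁ (proj₂ s)
        leave (v , g , g∈L , v∈g) = find (branching (All.lookup endpoints g∈L v∈g) g)

        via : State → Fin m
        via s = proj₁ (leave s)

        next : State → State
        next s = let h , h∈L , (w , J) , _ = leave s in w , h , h∈L , proj₁ s , Joins-sym E J

        moves : ∀ s → Joins E (via s) (proj₁ s) (proj₁ (next s))
        moves s = proj₂ (proj₁ (proj₂ (proj₂ (leave s))))

        open Unfold E proj₁ next via moves

        start : State
        start = proj₁ (E g₀) , g₀ , g₀∈L , proj₂ (E g₀) , inj₁ refl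

        turns : ∀ s → via (next s) ≢ via s
        turns s = proj₂ (proj₂ (proj₂ (leave (next s))))

        colours : ColourRepeatsEdgeOrHead (unfold start)
        colours s t same = inj₁ (injective (proj₁ (proj₂ (leave (orbit start s))))
                                           (proj₁ (proj₂ (leave (orbit start t)))) same)

      onlyVertex : ∀ {B : List (Fin n)} {v} → length (remove v B) ≤ 0 → ∀ {x} → x ∈ B → x ≡ v
      onlyVertex {B} {v} empty {x} x∈B with x Fin.≟ v
      ... | yes x≡v = x≡v
      ... | no  x≢v = ⊥-elim (ℕ.n≮0 (ℕ.<-≤-trans (∈-length (∈-remove⁺ x∈B x≢v)) empty))

      pruneLeaf : ∀ {B L v g} → All (EndpointsIn E B) L → ¬ LeavesAt L v g →
                  All (EndpointsIn E (remove v B)) (remove g L)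
      pruneLeaf {B} {L} {v} endpoints stuck = All.tabulate λ {h} h∈L′ {x} x∈h →
        let h∈L , h≢g = ∈-remove⁻ L h∈L′ in
        ∈-remove⁺ (All.lookup endpoints h∈L x∈h)
                  (λ x≡v → stuck (lose h∈L (subst (λ y → Incident E y h) x≡v x∈h , h≢g)))

      leaf-size : ∀ {B : List (Fin n)} {L : List (Fin m)} {v g} → Unique L → v ∈ B →
                  length B ≤ length L → length (remove v B) ≤ length (remove g L)
      leaf-size unique v∈B size =
        ℕ.≤-pred (ℕ.≤-trans (length-remove< v∈B) (ℕ.≤-trans size (length-remove≤ unique)))

      dense⇒rainbowCycle : ∀ B L → Acc _<_ (length B) → Unique L → ColourInjectiveOn c L →
                           All (EndpointsIn E B) L → length B ≤ length L → ∀ {g₀} → g₀ ∈ L →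
                           HasRainbowCycle E c
      dense⇒rainbowCycle B L (acc smaller) unique injective endpoints size {g₀} g₀∈L
        with leaf-or-branching B L
      ... | inj₂ branching = branching⇒rainbowCycle injective endpoints branching g₀∈L
      ... | inj₁ (v , g , v∈B , stuck) with remove g L in L⁻≡
      ...   | g₁ ∷ _ =
        dense⇒rainbowCycle (remove v B) (remove g L) (smaller (length-remove< v∈B)) (remove⁺ unique)
          (λ g∈L⁻ h∈L⁻ → injective (proj₁ (∈-remove⁻ L g∈L⁻)) (proj₁ (∈-remove⁻ L h∈L⁻)))
          (pruneLeaf endpoints stuck) (leaf-size unique v∈B size) (subst (g₁ ∈_) (sym L⁻≡) (here refl))
      ...   | [] = ⊥-elim (noLoop g₀ v (inj₁ (cong₂ _,_ (collapse (proj₂ (E g₀) , inj₁ refl))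
                                                         (collapse (proj₁ (E g₀) , inj₂ refl)))))
        where
        collapse : ∀ {x} → Incident E x g₀ → x ≡ v
        collapse x∈g₀ =
          onlyVertex (subst (λ L⁻ → length (remove v B) ≤ length L⁻) L⁻≡ (leaf-size {g = g} unique v∈B size))
                     (All.lookup endpoints g₀∈L x∈g₀)

    edges≥vertices⇒rainbowCycle : ∀ (B : List (Fin n)) (L : List (Fin m)) → Unique L → ColourInjectiveOn c L →
                                  All (EndpointsIn E B) L → length B ≤ length L → ∀ {g₀} → g₀ ∈ L →
                                  HasRainbowCycle E c
    edges≥vertices⇒rainbowCycle B L = dense⇒rainbowCycle B L (<-wellFounded (length B))

module _ {n m k : ℕ} (E : Fin m → Fin n × Fin n) (c : Fin m → Fin k) where

  record RainbowPathIn (A : List (Fin n)) (u v : Fin n) : Set where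
    constructor rainbowPathIn
    field
      walk    : Walk E u v
      isPath  : IsPath E c walk
      rainbow : Rainbow E c walk
      inside  : All (_∈ A) (walkVerts E walk)

    pathLength : ℕ
    pathLength = len E walk

  open RainbowPathIn public

  RainbowDistIn : List (Fin n) → Fin n → Fin n → ℕ → Set
  RainbowDistIn A u v d = (Σ (RainbowPathIn A u v) λ q → pathLength q ≡ d)
                        × (∀ (q : RainbowPathIn A u v) → d ≤ pathLength q)

  module _ {A : List (Fin n)} where

    reversePath : ∀ {u v} → RainbowPathIn A u v → RainbowPathIn A v u
    reversePath (rainbowPathIn p path rainbow inA) = rainbowPathIn
      (reverseWalk E p)
      (subst Unique (sym (walkVerts-reverse E p)) (Unique-reverse path))
      (subst Unique (sym (trans (cong (map c) (walkEdges-reverse E p)) (reverse-map c (walkEdges E p))))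
             (Unique-reverse rainbow))
      (subst (All (_∈ A)) (sym (walkVerts-reverse E p)) (All-reverse inA))

    pathLength-reverse : ∀ {u v} (q : RainbowPathIn A u v) → pathLength (reversePath q) ≡ pathLength q
    pathLength-reverse q =
      trans (cong length (walkEdges-reverse E (walk q))) (length-reverse (walkEdges E (walk q)))

    RainbowDistIn-sym : ∀ {u v d} → RainbowDistIn A u v d → RainbowDistIn A v u d
    RainbowDistIn-sym ((q , length≡d) , minimal) =
      (reversePath q , trans (pathLength-reverse q) length≡d) ,
      λ q′ → subst (_ ≤_) (pathLength-reverse q′) (minimal (reversePath q′))

    RainbowDistIn-functional : ∀ {u v d d′} → RainbowDistIn A u v d → RainbowDistIn A u v d′ → d ≡ d′
    RainbowDistIn-functional ((q , length≡d) , minimal) ((q′ , length≡d′) , minimal′) =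
      ℕ.≤-antisym (subst (_ ≤_) length≡d′ (minimal q′)) (subst (_ ≤_) length≡d (minimal′ q))

    RainbowDistIn-refl : ∀ {u} → u ∈ A → RainbowDistIn A u u 0
    RainbowDistIn-refl u∈A = (rainbowPathIn [] ([] ∷ []) [] (u∈A ∷ []) , refl) , λ _ → z≤n

    RainbowDistIn-endpoints : ∀ {u v d} → RainbowDistIn A u v d → u ∈ A × v ∈ A
    RainbowDistIn-endpoints ((q , _) , _) =
      All.lookup (inside q) (source∈walkVerts E (walk q)) , All.lookup (inside q) (target∈walkVerts E (walk q))

    RainbowDistIn-suc⇒≢ : ∀ {u w d} → RainbowDistIn A u w (suc d) → u ≢ w
    RainbowDistIn-suc⇒≢ dist refl
      with RainbowDistIn-functional dist (RainbowDistIn-refl (proj₁ (RainbowDistIn-endpoints dist)))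
    ... | ()

    RainbowDistIn-edge : ∀ {g u v} → Joins E g u v → u ≢ v → u ∈ A → v ∈ A → RainbowDistIn A u v 1
    RainbowDistIn-edge {g} J u≢v u∈A v∈A =
      (rainbowPathIn (step g J []) ((u≢v ∷ []) ∷ [] ∷ []) ([] ∷ []) (u∈A ∷ v∈A ∷ []) , refl) ,
      λ q → nonempty (walk q)
      where
      nonempty : (p : Walk E _ _) → 1 ≤ len E p
      nonempty []           = ⊥-elim (u≢v refl)
      nonempty (step _ _ _) = s≤s z≤n

  RainbowDiameter≤ : List (Fin n) → ℕ → Set
  RainbowDiameter≤ A B = ∀ {u v} → u ∈ A → v ∈ A → ∃ λ d → RainbowDistIn A u v d × d ≤ B

  FarPairUnique : List (Fin n) → ℕ → Set
  FarPairUnique A d = ∀ {u v u′ v′} → RainbowDistIn A u v d → RainbowDistIn A u′ v′ d → SamePair u v u′ v′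

  CommonFarVertexUnique : List (Fin n) → ℕ → Set
  CommonFarVertexUnique A d = ∀ {y y′ v v′} → y ≢ y′ →
    RainbowDistIn A y v d → RainbowDistIn A y′ v d → RainbowDistIn A y v′ d → RainbowDistIn A y′ v′ d → v ≡ v′

  module _ {A : List (Fin n)} {d : ℕ} (farPairUnique : FarPairUnique A d) where

    farPairUnique-target : ∀ {u u′ w} → RainbowDistIn A u w d → RainbowDistIn A u′ w d → u ≡ u′
    farPairUnique-target dist dist′ = samePair-common (farPairUnique dist dist′)

    farPairUnique-source : ∀ {u w w′} → RainbowDistIn A u w d → RainbowDistIn A u w′ d → w ≡ w′
    farPairUnique-source dist dist′ = farPairUnique-target (RainbowDistIn-sym dist) (RainbowDistIn-sym dist′)

  module _ {u v : Fin n} where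

    RainbowDistIn-allFin⁺ : ∀ {d} → RainbowDist E c u v d → RainbowDistIn (allFin n) u v d
    RainbowDistIn-allFin⁺ ((q , length≡d) , minimal) = (inAll q , length≡d) , minimal ∘ forget
      where
      inAll : RainbowPath E c u v → RainbowPathIn (allFin n) u v
      inAll (p , path , rainbow) = rainbowPathIn p path rainbow (All.tabulate λ {w} _ → ∈-allFin w)
      forget : RainbowPathIn (allFin n) u v → RainbowPath E c u v
      forget q = walk q , isPath q , rainbow q

    RainbowDistIn-allFin⁻ : ∀ {d} → RainbowDistIn (allFin n) u v d → RainbowDist E c u v d
    RainbowDistIn-allFin⁻ ((q , length≡d) , minimal) =
      ((walk q , isPath q , rainbow q) , length≡d) ,
      λ (p , path , rainbow) → minimal (rainbowPathIn p path rainbow (All.tabulate λ {w} _ → ∈-allFin w))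

  RainbowDiameter≤-allFin : ∀ {B} → RainbowDiameter≤ (allFin n) B →
                            ∀ u v → u ≢ v → Σ ℕ λ d → RainbowDist E c u v d × d ≤ B
  RainbowDiameter≤-allFin diameter u v _ =
    let d , dist , d≤B = diameter (∈-allFin u) (∈-allFin v) in d , RainbowDistIn-allFin⁻ dist , d≤B

  FarPairUnique-allFin : ∀ {d} → FarPairUnique (allFin n) d →
                         ∀ u v u′ v′ → RainbowDist E c u v d → RainbowDist E c u′ v′ d → SamePair u v u′ v′
  FarPairUnique-allFin farPair u v u′ v′ dist dist′ =
    farPair (RainbowDistIn-allFin⁺ dist) (RainbowDistIn-allFin⁺ dist′)

-- Colour classes and their owners

module _ {n m k : ℕ} (E : Fin m → Fin n × Fin n) (c : Fin m → Fin k) where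

  SingletonClass : Fin k → Set
  SingletonClass i = ∃ λ e → c e ≡ i × (∀ g → c g ≡ i → g ≡ e)

  PairClass : Fin k → Set
  PairClass i = ∃₂ λ p q → p ≢ q × c p ≡ i × c q ≡ i × (∀ g → c g ≡ i → g ≡ p ⊎ g ≡ q)

  private
    members : Fin k → List (Fin m)
    members i = filter (λ g → c g Fin.≟ i) (allFin m)

    ∈-members⁺ : ∀ {g i} → c g ≡ i → g ∈ members i
    ∈-members⁺ {g} {i} = ∈-filter⁺ (λ g → c g Fin.≟ i) (∈-allFin g)

    ∈-members⁻ : ∀ {g i} → g ∈ members i → c g ≡ i
    ∈-members⁻ {i = i} g∈ = proj₂ (∈-filter⁻ (λ g → c g Fin.≟ i) {xs = allFin m} g∈)

    members-unique : ∀ i → Unique (members i)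
    members-unique i = filter⁺ (λ g → c g Fin.≟ i) (allFin⁺ m)

  classSize≡1⇒singleton : ∀ i → classSize E c i ≡ 1 → SingletonClass i
  classSize≡1⇒singleton i size with members i in eq | size
  ... | e ∷ [] | _ = e , ∈-members⁻ (subst (e ∈_) (sym eq) (here refl)) ,
                     λ g cg≡i → only (subst (g ∈_) eq (∈-members⁺ cg≡i))
    where
    only : ∀ {g} → g ∈ e ∷ [] → g ≡ e
    only (here g≡e) = g≡e

  classSize≡2⇒pair : ∀ i → classSize E c i ≡ 2 → PairClass i
  classSize≡2⇒pair i size with members i in eq | size | members-unique i
  ... | p ∷ q ∷ [] | _ | _ = p , q , p≢q , colour (here refl) , colour (there (here refl)) ,
                             λ g cg≡i → only (subst (g ∈_) eq (∈-members⁺ cg≡i))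
    where
    colour : ∀ {g} → g ∈ p ∷ q ∷ [] → c g ≡ i
    colour g∈ = ∈-members⁻ (subst (_ ∈_) (sym eq) g∈)
    p≢q : p ≢ q
    p≢q with subst Unique eq (members-unique i)
    ... | (p≢q ∷ []) ∷ _ = p≢q
    only : ∀ {g} → g ∈ p ∷ q ∷ [] → g ≡ p ⊎ g ≡ q
    only (here g≡p)         = inj₁ g≡p
    only (there (here g≡q)) = inj₂ g≡q

module Ownership {K m : ℕ} {E : Fin m → Fin (suc K) × Fin (suc K)} {c : Fin m → Fin K}
                 (simple : Simple E) (rainbowCycleFree : ¬ HasRainbowCycle E c)
                 {z : Fin K} (singleton : SingletonClass E c z) (pairs : ∀ i → i ≢ z → PairClass E c i) where

  Owns : Fin (suc K) → Fin K → Set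
  Owns x i = ∀ g → c g ≡ i → Incident E x g

  private
    owns? : ∀ x i → Dec (Owns x i)
    owns? x i = Fin.all? λ g → (c g Fin.≟ i) →-dec incident? E x g

    avoiding : ∀ {x i} → ¬ Owns x i → ∃ λ g → c g ≡ i × ¬ Incident E x g
    avoiding {x} {i} ¬owns with Fin.¬∀⟶∃¬ m _ (λ g → (c g Fin.≟ i) →-dec incident? E x g) ¬owns
    ... | g , ¬implication with c g Fin.≟ i
    ...   | yes cg≡i = g , cg≡i , λ x∈g → ¬implication (λ _ → x∈g)
    ...   | no  cg≢i = ⊥-elim (¬implication (λ cg≡i → ⊥-elim (cg≢i cg≡i)))

  -- Otherwise one edge of each colour avoiding x gives K edges of distinct colours on the
  -- K other vertices, and such a graph has a (rainbow) cycle.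
  owner-exists : ∀ x → ∃ (Owns x)
  owner-exists x with Fin.any? (owns? x)
  ... | yes owned = owned
  ... | no ¬owned = ⊥-elim (rainbowCycleFree
        (edges≥vertices⇒rainbowCycle c simple B L unique injective endpoints size (∈-map⁺ pick (∈-allFin z))))
    where
    choice : ∀ i → ∃ λ g → c g ≡ i × ¬ Incident E x g
    choice i = avoiding (λ owns → ¬owned (i , owns))
    pick : Fin K → Fin m
    pick i = proj₁ (choice i)
    pick-colour : ∀ i → c (pick i) ≡ i
    pick-colour i = proj₁ (proj₂ (choice i))
    B : List (Fin (suc K))
    B = remove x (allFin (suc K))
    L : List (Fin m)
    L = map pick (allFin K)
    unique : Unique L
    unique = map⁺ (λ {i} {j} same → trans (sym (pick-colour i)) (trans (cong c same) (pick-colour j))) (allFin⁺ K)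
    injective : ColourInjectiveOn c L
    injective g∈L h∈L same with ∈-map⁻ pick g∈L | ∈-map⁻ pick h∈L
    ... | i , _ , refl | j , _ , refl = cong pick (trans (sym (pick-colour i)) (trans same (pick-colour j)))
    endpoints : All (EndpointsIn E B) L
    endpoints = All.map⁺ (All.tabulate λ {i} _ {y} y∈g →
      ∈-remove⁺ (∈-allFin y) (λ y≡x → proj₂ (proj₂ (choice i)) (subst (λ v → Incident E v (pick i)) y≡x y∈g)))
    size : length B ≤ length L
    size = ℕ.≤-reflexive (ℕ.suc-injective (begin
      suc (length B)          ≡⟨ length-remove (allFin⁺ (suc K)) (∈-allFin x) ⟨
      length (allFin (suc K)) ≡⟨ length-tabulate id ⟩
      suc K                   ≡⟨ cong suc (trans (length-map pick (allFin K)) (length-tabulate id)) ⟨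
      suc (length L)          ∎))
      where open ≡-Reasoning

  -- Opaque: unfolding the decision procedure behind this choice makes type checking blow up.
  opaque
    owned : Fin (suc K) → Fin K
    owned x = proj₁ (owner-exists x)

    owns-owned : ∀ x → Owns x (owned x)
    owns-owned x = proj₂ (owner-exists x)

  e₁ : Fin m
  e₁ = proj₁ singleton

  a b : Fin (suc K)
  a = proj₁ (E e₁)
  b = proj₂ (E e₁)

  a≢b : a ≢ b
  a≢b a≡b = proj₁ simple e₁ a (inj₁ (cong (a ,_) (sym a≡b)))

  Inner : Fin (suc K) → Set
  Inner x = x ≢ a × x ≢ b

  inner? : ∀ x → Dec (Inner x)
  inner? x = ¬? (x Fin.≟ a) ×-dec ¬? (x Fin.≟ b)

  Inner⇒¬Incident-e₁ : ∀ {x} → Inner x → ¬ Incident E x e₁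
  Inner⇒¬Incident-e₁ (x≢a , x≢b) x∈e₁ with Incident-endpoint E (inj₁ refl) x∈e₁
  ... | inj₁ x≡a = x≢a x≡a
  ... | inj₂ x≡b = x≢b x≡b

  Inner⇒colour≢z : ∀ {x g w} → Inner x → Joins E g x w → c g ≢ z
  Inner⇒colour≢z {x} inner J cg≡z =
    Inner⇒¬Incident-e₁ inner (subst (Incident E x) (proj₂ (proj₂ singleton) _ cg≡z) (_ , J))

  owned≢z : ∀ {x} → Inner x → owned x ≢ z
  owned≢z {x} inner owned≡z =
    Inner⇒¬Incident-e₁ inner (owns-owned x e₁ (trans (proj₁ (proj₂ singleton)) (sym owned≡z)))

  owner-unique : ∀ {i x y} → i ≢ z → Owns x i → Owns y i → x ≡ y
  owner-unique {i} {x} {y} i≢z x-owns y-owns with x Fin.≟ y | pairs i i≢z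
  ... | yes x≡y | _ = x≡y
  ... | no  x≢y | p , q , p≢q , cp , cq , _ =
    ⊥-elim (p≢q (proj₂ simple p q x y (Incident⇒Joins E (x-owns p cp) (y-owns p cp) x≢y)
                                      (Incident⇒Joins E (x-owns q cq) (y-owns q cq) x≢y)))

  owned-injective : ∀ {x y} → Inner x → Inner y → owned x ≡ owned y → x ≡ y
  owned-injective {x} {y} x-inner _ same =
    owner-unique (owned≢z x-inner) (owns-owned x) (subst (Owns y) (sym same) (owns-owned y))

  Kind : Fin (suc K) → Set
  Kind x = x ≡ a ⊎ x ≡ b ⊎ Inner x

  classify : ∀ x → Kind x
  classify x with x Fin.≟ a | x Fin.≟ b
  ... | yes x≡a | _       = inj₁ x≡a
  ... | no  _   | yes x≡b = inj₂ (inj₁ x≡b)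
  ... | no  x≢a | no  x≢b = inj₂ (inj₂ (x≢a , x≢b))

  private
    relabel : Fin K → ∀ {x} → Kind x → Fin K
    relabel i     (inj₁ _)        = z
    relabel i     (inj₂ (inj₁ _)) = i
    relabel i {x} (inj₂ (inj₂ _)) = owned x

    relabel-injective : ∀ {i} → i ≢ z → (∀ {o} → Inner o → owned o ≢ i) →
                        ∀ {x y} (kx : Kind x) (ky : Kind y) → relabel i kx ≡ relabel i ky → x ≡ y
    relabel-injective _ _ (inj₁ refl) (inj₁ refl) _ = refl
    relabel-injective i≢z _ (inj₁ _) (inj₂ (inj₁ _)) z≡i = ⊥-elim (i≢z (sym z≡i))
    relabel-injective _ _ (inj₁ _) (inj₂ (inj₂ y-inner)) z≡owned = ⊥-elim (owned≢z y-inner (sym z≡owned))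
    relabel-injective i≢z _ (inj₂ (inj₁ _)) (inj₁ _) i≡z = ⊥-elim (i≢z i≡z)
    relabel-injective _ _ (inj₂ (inj₁ refl)) (inj₂ (inj₁ refl)) _ = refl
    relabel-injective _ unowned (inj₂ (inj₁ _)) (inj₂ (inj₂ y-inner)) i≡owned = ⊥-elim (unowned y-inner (sym i≡owned))
    relabel-injective _ _ (inj₂ (inj₂ x-inner)) (inj₁ _) owned≡z = ⊥-elim (owned≢z x-inner owned≡z)
    relabel-injective _ unowned (inj₂ (inj₂ x-inner)) (inj₂ (inj₁ _)) owned≡i = ⊥-elim (unowned x-inner owned≡i)
    relabel-injective _ _ (inj₂ (inj₂ x-inner)) (inj₂ (inj₂ y-inner)) same = owned-injective x-inner y-inner same

  -- Otherwise a ↦ z, b ↦ i and x ↦ owned x would inject the K + 1 vertices into the K colours.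
  owner-of : ∀ i → i ≢ z → ∃ λ o → Inner o × owned o ≡ i
  owner-of i i≢z with Fin.any? (λ o → inner? o ×-dec (owned o Fin.≟ i))
  ... | yes found = found
  ... | no ¬found with pigeonhole (ℕ.n<1+n K) (λ x → relabel i (classify x))
  ...   | x , y , x<y , same = ⊥-elim (Fin.<⇒≢ x<y
          (relabel-injective i≢z (λ o-inner owned≡i → ¬found (_ , o-inner , owned≡i)) (classify x) (classify y) same))

  step-to-owner : ∀ {x g w} → Inner x → Joins E g x w → c g ≢ owned x → Inner w × owned w ≡ c g
  step-to-owner {x} {g} {w} x-inner J cg≢owned with owner-of (c g) (Inner⇒colour≢z x-inner J)
  ... | o , o-inner , owned≡cg = subst Inner o≡w o-inner , trans (cong owned (sym o≡w)) owned≡cg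
    where
    x≢o : x ≢ o
    x≢o x≡o = cg≢owned (trans (sym owned≡cg) (cong owned (sym x≡o)))
    o≡w : o ≡ w
    o≡w = Joins-functional E (Incident⇒Joins E (_ , J) (owns-owned o g (sym owned≡cg)) x≢o) J

-- Pruning admissible vertex sets

⊓<-unless-both : ∀ {d₁ d₂ k} → d₁ ≤ k → d₂ ≤ k → (d₁ ≡ k → d₂ ≢ k) → d₁ ⊓ d₂ < k
⊓<-unless-both {d₁} {d₂} d₁≤k d₂≤k not-both with ℕ.m≤n⇒m<n∨m≡n d₁≤k | ℕ.m≤n⇒m<n∨m≡n d₂≤k
... | inj₁ d₁<k | _         = ℕ.≤-<-trans (ℕ.m⊓n≤m d₁ d₂) d₁<k
... | inj₂ _    | inj₁ d₂<k = ℕ.≤-<-trans (ℕ.m⊓n≤n d₁ d₂) d₂<k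
... | inj₂ d₁≡k | inj₂ d₂≡k = ⊥-elim (not-both d₁≡k d₂≡k)

⊓≡-both : ∀ {d₁ d₂ k} → d₁ ≤ k → d₂ ≤ k → d₁ ⊓ d₂ ≡ k → d₁ ≡ k × d₂ ≡ k
⊓≡-both {d₁} {d₂} d₁≤k d₂≤k ⊓≡k =
  ℕ.≤-antisym d₁≤k (subst (_≤ d₁) ⊓≡k (ℕ.m⊓n≤m d₁ d₂)) , ℕ.≤-antisym d₂≤k (subst (_≤ d₂) ⊓≡k (ℕ.m⊓n≤n d₁ d₂))

module Pruning {K m : ℕ} {E : Fin m → Fin (suc K) × Fin (suc K)} {c : Fin m → Fin K}
               (simple : Simple E) (rainbowCycleFree : ¬ HasRainbowCycle E c)
               {z : Fin K} (singleton : SingletonClass E c z) (pairs : ∀ i → i ≢ z → PairClass E c i) where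

  open Ownership simple rainbowCycleFree singleton pairs
  open import Data.List.Membership.DecPropositional (Fin._≟_ {suc K}) using (_∈?_)

  Closed : List (Fin (suc K)) → Set
  Closed A = ∀ {x g w} → x ∈ A → Inner x → c g ≡ owned x → Joins E g x w → w ∈ A

  record Admissible (A : List (Fin (suc K))) : Set where
    field
      unique : Unique A
      a∈A    : a ∈ A
      b∈A    : b ∈ A
      closed : Closed A

  Removable : List (Fin (suc K)) → Fin (suc K) → Set
  Removable A x = x ∈ A × Inner x × (∀ {g w} → Joins E g x w → w ∈ A → c g ≡ owned x)

  innerPart : List (Fin (suc K)) → List (Fin (suc K))
  innerPart A = remove b (remove a A)

  module _ {A : List (Fin (suc K))} (admissible : Admissible A) where

    open Admissible admissible

    length-innerPart : length A ≡ 2 + length (innerPart A)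
    length-innerPart = trans (length-remove unique a∈A)
      (cong suc (length-remove (remove⁺ unique) (∈-remove⁺ b∈A (a≢b ∘ sym))))

    ∈-innerPart⁺ : ∀ {x} → x ∈ A → Inner x → x ∈ innerPart A
    ∈-innerPart⁺ x∈A (x≢a , x≢b) = ∈-remove⁺ (∈-remove⁺ x∈A x≢a) x≢b

    ∈-innerPart⁻ : ∀ {x} → x ∈ innerPart A → x ∈ A × Inner x
    ∈-innerPart⁻ x∈ = let x∈A⁻ , x≢b = ∈-remove⁻ (remove a A) x∈ ; x∈A , x≢a = ∈-remove⁻ A x∈A⁻ in
                      x∈A , x≢a , x≢b

    inner-member : 3 ≤ length A → ∃ λ x → x ∈ A × Inner x
    inner-member size with innerPart A in eq | length-innerPart
    ... | x ∷ _ | _     = x , ∈-innerPart⁻ (subst (x ∈_) (sym eq) (here refl))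
    ... | []    | A≡2 = ⊥-elim (ℕ.<-irrefl refl (subst (3 ≤_) A≡2 size))

  private
    Exit : List (Fin (suc K)) → Fin (suc K) → Set
    Exit A x = ∃₂ λ g w → Joins E g x w × w ∈ A × c g ≢ owned x

    exit? : ∀ A x → Dec (Exit A x)
    exit? A x = Fin.any? λ g → Fin.any? λ w → joins? E g x w ×-dec (w ∈? A) ×-dec ¬? (c g Fin.≟ owned x)

  -- Otherwise leave each inner vertex of A along an edge into A of a colour it does not own.
  -- Such an edge ends at the owner of its colour, another inner vertex of A, so the walk goes
  -- on forever and each step has the colour owned by the vertex it reaches: its first closed
  -- stretch is a rainbow cycle.
  removable-exists : ∀ {A} → Admissible A → 3 ≤ length A → ∃ (Removable A)
  removable-exists {A} admissible size with Fin.any? (λ x → (x ∈? A) ×-dec inner? x ×-dec ¬? (exit? A x))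
  ... | yes (x , x∈A , inner , ¬exit) =
    x , x∈A , inner , λ {g} J w∈A → decidable-stable (c g Fin.≟ owned x) (λ cg≢ → ¬exit (g , _ , J , w∈A , cg≢))
  ... | no none = ⊥-elim (rainbowCycleFree (nonBacktracking⇒rainbowCycle c simple (unfold start) turns colours))
    where
    State : Set
    State = ∃ λ x → x ∈ A × Inner x

    exit : (s : State) → Exit A (proj₁ s)
    exit (x , x∈A , inner) = decidable-stable (exit? A x) (λ ¬exit → none (x , x∈A , inner , ¬exit))

    via : State → Fin m
    via s = proj₁ (exit s)

    moves : ∀ s → Joins E (via s) (proj₁ s) (proj₁ (proj₂ (exit s)))
    moves s = proj₁ (proj₂ (proj₂ (exit s)))

    arrival : ∀ s → Inner (proj₁ (proj₂ (exit s))) × owned (proj₁ (proj₂ (exit s))) ≡ c (via s)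
    arrival s@(_ , _ , inner) = let _ , _ , J , _ , foreign = exit s in step-to-owner inner J foreign

    next : State → State
    next s = let _ , w , _ , w∈A , _ = exit s in w , w∈A , proj₁ (arrival s)

    open Unfold E proj₁ next via moves

    start : State
    start = inner-member admissible size

    turns : NonBacktracking c simple (unfold start)
    turns t same = foreign (trans (cong c same) (sym (proj₂ (arrival s))))
      where
      s : State
      s = orbit start t
      foreign : c (via (next s)) ≢ owned (proj₁ (next s))
      foreign = proj₂ (proj₂ (proj₂ (proj₂ (exit (next s)))))

    colours : ColourRepeatsEdgeOrHead c simple (unfold start)
    colours s t same = inj₂ (owned-injective (proj₁ (arrival (orbit start s))) (proj₁ (arrival (orbit start t)))
      (trans (proj₂ (arrival (orbit start s))) (trans same (sym (proj₂ (arrival (orbit start t)))))))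

  module Removal {A : List (Fin (suc K))} (admissible : Admissible A)
                 {x : Fin (suc K)} (removable : Removable A x) where

    open Admissible admissible

    private
      x∈A : x ∈ A
      x∈A = proj₁ removable

      x-inner : Inner x
      x-inner = proj₁ (proj₂ removable)

      own-colour : ∀ {g w} → Joins E g x w → w ∈ A → c g ≡ owned x
      own-colour = proj₂ (proj₂ removable)

    A⁻ : List (Fin (suc K))
    A⁻ = remove x A

    private
      ∈A⁻⇒∈A : ∀ {w} → w ∈ A⁻ → w ∈ A
      ∈A⁻⇒∈A = proj₁ ∘ ∈-remove⁻ A

      ∈A⁻⇒≢x : ∀ {w} → w ∈ A⁻ → w ≢ x
      ∈A⁻⇒≢x = proj₂ ∘ ∈-remove⁻ A

    length-A⁻ : length A ≡ suc (length A⁻)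
    length-A⁻ = length-remove unique x∈A

    admissible⁻ : Admissible A⁻
    admissible⁻ = record
      { unique = remove⁺ unique
      ; a∈A    = ∈-remove⁺ a∈A (proj₁ x-inner ∘ sym)
      ; b∈A    = ∈-remove⁺ b∈A (proj₂ x-inner ∘ sym)
      ; closed = λ {x₀} {g} x₀∈A⁻ x₀-inner cg J → ∈-remove⁺ (closed (∈A⁻⇒∈A x₀∈A⁻) x₀-inner cg J) λ w≡x →
                   ∈A⁻⇒≢x x₀∈A⁻ (owned-injective x₀-inner x-inner
                     (trans (sym cg) (own-colour (Joins-sym E (subst (Joins E g x₀) w≡x J)) (∈A⁻⇒∈A x₀∈A⁻))))
      }

    private
      ownClass : PairClass E c (owned x)
      ownClass = pairs (owned x) (owned≢z x-inner)

      f₁ f₂ : Fin m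
      f₁ = proj₁ ownClass
      f₂ = proj₁ (proj₂ ownClass)

      c-f₁ : c f₁ ≡ owned x
      c-f₁ = proj₁ (proj₂ (proj₂ (proj₂ ownClass)))

      c-f₂ : c f₂ ≡ owned x
      c-f₂ = proj₁ (proj₂ (proj₂ (proj₂ (proj₂ ownClass))))

      own-edges : ∀ g → c g ≡ owned x → g ≡ f₁ ⊎ g ≡ f₂
      own-edges = proj₂ (proj₂ (proj₂ (proj₂ (proj₂ ownClass))))

    y₁ y₂ : Fin (suc K)
    y₁ = proj₁ (owns-owned x f₁ c-f₁)
    y₂ = proj₁ (owns-owned x f₂ c-f₂)

    private
      J₁ : Joins E f₁ x y₁
      J₁ = proj₂ (owns-owned x f₁ c-f₁)

      J₂ : Joins E f₂ x y₂
      J₂ = proj₂ (owns-owned x f₂ c-f₂)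

      neighbour∈A⁻ : ∀ {f y} → c f ≡ owned x → Joins E f x y → y ∈ A⁻
      neighbour∈A⁻ {f} cf J =
        ∈-remove⁺ (closed x∈A x-inner cf J) (λ y≡x → proj₁ simple f x (subst (Joins E f x) y≡x J))

    y₁∈A⁻ : y₁ ∈ A⁻
    y₁∈A⁻ = neighbour∈A⁻ c-f₁ J₁

    y₂∈A⁻ : y₂ ∈ A⁻
    y₂∈A⁻ = neighbour∈A⁻ c-f₂ J₂

    y₁≢y₂ : y₁ ≢ y₂
    y₁≢y₂ y₁≡y₂ = proj₁ (proj₂ (proj₂ ownClass)) (proj₂ simple f₁ f₂ x y₂ (subst (Joins E f₁ x) y₁≡y₂ J₁) J₂)

    -- A rainbow path through x would use two edges at x into A, both of x's colour.
    avoids-x : ∀ {u v} (p : Walk E u v) → Rainbow E c p → All (_∈ A) (walkVerts E p) → u ≢ x → v ≢ x →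
               All (_≢ x) (walkVerts E p)
    avoids-x []            _ _ u≢x _   = u≢x ∷ []
    avoids-x (step g J []) _ _ u≢x v≢x = u≢x ∷ v≢x ∷ []
    avoids-x {u} (step g J p@(step h J′ q)) (cg∉ ∷ rainbow) (u∈A ∷ inA) u≢x v≢x =
      u≢x ∷ avoids-x p rainbow inA w≢x v≢x
      where
      w≢x : _ ≢ x
      w≢x w≡x = All.head cg∉ (trans (own-colour (Joins-sym E (subst (Joins E g u) w≡x J)) u∈A)
                                    (sym (own-colour (subst (λ w → Joins E h w _) w≡x J′)
                                                     (All.lookup inA (there (source∈walkVerts E q))))))

    edges-avoid-x : ∀ {u v} (p : Walk E u v) → All (_∈ A⁻) (walkVerts E p) → All (¬_ ∘ Incident E x) (walkEdges E p)
    edges-avoid-x []           _                = []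
    edges-avoid-x (step g J p) (u∈A⁻ ∷ inA⁻) =
      [ ∈A⁻⇒≢x u∈A⁻ ∘ sym , ∈A⁻⇒≢x (All.lookup inA⁻ (source∈walkVerts E p)) ∘ sym ]′ ∘ Incident-endpoint E J
      ∷ edges-avoid-x p inA⁻

    path⁻ : ∀ {u v} → u ≢ x → v ≢ x → RainbowPathIn E c A u v → RainbowPathIn E c A⁻ u v
    path⁻ u≢x v≢x (rainbowPathIn p path rainbow inA) =
      rainbowPathIn p path rainbow
        (All.zipWith (λ (w∈A , w≢x) → ∈-remove⁺ w∈A w≢x) (inA , avoids-x p rainbow inA u≢x v≢x))

    path⁺ : ∀ {u v} → RainbowPathIn E c A⁻ u v → RainbowPathIn E c A u v
    path⁺ (rainbowPathIn p path rainbow inA⁻) = rainbowPathIn p path rainbow (All.map ∈A⁻⇒∈A inA⁻)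

    dist⁻ : ∀ {u v d} → u ≢ x → v ≢ x → RainbowDistIn E c A u v d → RainbowDistIn E c A⁻ u v d
    dist⁻ u≢x v≢x ((q , length≡d) , minimal) = (path⁻ u≢x v≢x q , length≡d) , minimal ∘ path⁺

    dist⁺ : ∀ {u v d} → u ≢ x → v ≢ x → RainbowDistIn E c A⁻ u v d → RainbowDistIn E c A u v d
    dist⁺ u≢x v≢x ((q , length≡d) , minimal) = (path⁺ q , length≡d) , minimal ∘ path⁻ u≢x v≢x

    extend : ∀ {f y v} → Joins E f x y → c f ≡ owned x → RainbowPathIn E c A⁻ y v → RainbowPathIn E c A x v
    extend {f} J cf (rainbowPathIn p path rainbow inA⁻) = rainbowPathIn (step f J p)
      (All.map (λ w∈A⁻ x≡w → ∈A⁻⇒≢x w∈A⁻ (sym x≡w)) inA⁻ ∷ path)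
      (All.map⁺ (All.map (λ x∉g cf≡cg → x∉g (owns-owned x _ (trans (sym cf≡cg) cf))) (edges-avoid-x p inA⁻))
       ∷ rainbow)
      (x∈A ∷ All.map ∈A⁻⇒∈A inA⁻)

    leave-x : ∀ {v} (q : RainbowPathIn E c A x v) → v ≢ x →
                ∃ λ y → (y ≡ y₁ ⊎ y ≡ y₂) × Σ (RainbowPathIn E c A⁻ y v) λ r → pathLength q ≡ suc (pathLength r)
    leave-x (rainbowPathIn [] _ _ _) v≢x = ⊥-elim (v≢x refl)
    leave-x (rainbowPathIn (step {w = w} g J p) (x∉ ∷ path) (_ ∷ rainbow) (_ ∷ inA)) _ =
      w , neighbour , rainbowPathIn p path rainbow inA⁻ , refl
      where
      inA⁻ : All (_∈ A⁻) (walkVerts E p)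
      inA⁻ = All.zipWith (λ (w∈A , x≢w) → ∈-remove⁺ w∈A (x≢w ∘ sym)) (inA , x∉)
      neighbour : w ≡ y₁ ⊎ w ≡ y₂
      neighbour with own-edges g (own-colour J (All.lookup inA (source∈walkVerts E p)))
      ... | inj₁ g≡f₁ = inj₁ (Joins-functional E J (subst (λ f → Joins E f x y₁) (sym g≡f₁) J₁))
      ... | inj₂ g≡f₂ = inj₂ (Joins-functional E J (subst (λ f → Joins E f x y₂) (sym g≡f₂) J₂))

    dist-from-x : ∀ {v d₁ d₂} → v ≢ x → RainbowDistIn E c A⁻ y₁ v d₁ → RainbowDistIn E c A⁻ y₂ v d₂ →
                  RainbowDistIn E c A x v (suc (d₁ ⊓ d₂))
    dist-from-x {v} {d₁} {d₂} v≢x ((q₁ , length≡d₁) , minimal₁) ((q₂ , length≡d₂) , minimal₂) = shortest , minimal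
      where
      shortest : Σ (RainbowPathIn E c A x v) λ q → pathLength q ≡ suc (d₁ ⊓ d₂)
      shortest with ℕ.≤-total d₁ d₂
      ... | inj₁ d₁≤d₂ = extend J₁ c-f₁ q₁ , cong suc (trans length≡d₁ (sym (ℕ.m≤n⇒m⊓n≡m d₁≤d₂)))
      ... | inj₂ d₂≤d₁ = extend J₂ c-f₂ q₂ , cong suc (trans length≡d₂ (sym (ℕ.m≥n⇒m⊓n≡n d₂≤d₁)))
      minimal : ∀ q → suc (d₁ ⊓ d₂) ≤ pathLength q
      minimal q with leave-x q v≢x
      ... | _ , inj₁ refl , r , length≡ = subst (_ ≤_) (sym length≡) (s≤s (ℕ.≤-trans (ℕ.m⊓n≤m d₁ d₂) (minimal₁ r)))
      ... | _ , inj₂ refl , r , length≡ = subst (_ ≤_) (sym length≡) (s≤s (ℕ.≤-trans (ℕ.m⊓n≤n d₁ d₂) (minimal₂ r)))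

    neighbour-dists : ∀ {B v} → RainbowDiameter≤ E c A⁻ B → v ∈ A → v ≢ x →
                      ∃₂ λ d₁ d₂ → RainbowDistIn E c A⁻ y₁ v d₁ × RainbowDistIn E c A⁻ y₂ v d₂ × d₁ ≤ B × d₂ ≤ B
    neighbour-dists diameter⁻ v∈A v≢x =
      let d₁ , dist₁ , d₁≤B = diameter⁻ y₁∈A⁻ (∈-remove⁺ v∈A v≢x)
          d₂ , dist₂ , d₂≤B = diameter⁻ y₂∈A⁻ (∈-remove⁺ v∈A v≢x)
      in d₁ , d₂ , dist₁ , dist₂ , d₁≤B , d₂≤B

    diameter : ∀ {B B⁻} → B⁻ ≤ B → (∀ {v} → v ∈ A → v ≢ x → ∃ λ d → RainbowDistIn E c A x v d × d ≤ B) →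
               RainbowDiameter≤ E c A⁻ B⁻ → RainbowDiameter≤ E c A B
    diameter {B} B⁻≤B from-x diameter⁻ {u} {v} u∈A v∈A with u Fin.≟ x | v Fin.≟ x
    ... | yes refl | yes refl = 0 , RainbowDistIn-refl E c u∈A , z≤n
    ... | yes refl | no  v≢x  = from-x v∈A v≢x
    ... | no  u≢x  | yes refl = let d , dist , d≤B = from-x u∈A u≢x in d , RainbowDistIn-sym E c dist , d≤B
    ... | no  u≢x  | no  v≢x  = let d , dist , d≤B⁻ = diameter⁻ (∈-remove⁺ u∈A u≢x) (∈-remove⁺ v∈A v≢x) in
                                d , dist⁺ u≢x v≢x dist , ℕ.≤-trans d≤B⁻ B⁻≤B

    odd-step : ∀ {t} → RainbowDiameter≤ E c A⁻ (suc t) → FarPairUnique E c A⁻ (suc t) →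
               RainbowDiameter≤ E c A (suc t) × CommonFarVertexUnique E c A (suc t)
    odd-step {t} diameter⁻ farPair⁻ = diameter ℕ.≤-refl from-x diameter⁻ , commonFar
      where
      from-x : ∀ {v} → v ∈ A → v ≢ x → ∃ λ d → RainbowDistIn E c A x v d × d ≤ suc t
      from-x v∈A v≢x =
        let d₁ , d₂ , dist₁ , dist₂ , d₁≤ , d₂≤ = neighbour-dists diameter⁻ v∈A v≢x in
        suc (d₁ ⊓ d₂) , dist-from-x v≢x dist₁ dist₂ ,
        ⊓<-unless-both d₁≤ d₂≤ λ d₁≡ d₂≡ → y₁≢y₂ (farPairUnique-target E c farPair⁻
          (subst (RainbowDistIn E c A⁻ y₁ _) d₁≡ dist₁) (subst (RainbowDistIn E c A⁻ y₂ _) d₂≡ dist₂))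

      commonFar : CommonFarVertexUnique E c A (suc t)
      commonFar {y} {y′} {v} {v′} y≢y′ yv y′v yv′ y′v′ with v Fin.≟ x | v′ Fin.≟ x
      ... | yes v≡x | yes v′≡x = trans v≡x (sym v′≡x)
      ... | yes v≡x | no  v′≢x = ⊥-elim (y≢y′ (farPairUnique-target E c farPair⁻
                                    (dist⁻ (RainbowDistIn-suc⇒≢ E c yv ∘ flip trans (sym v≡x)) v′≢x yv′)
                                    (dist⁻ (RainbowDistIn-suc⇒≢ E c y′v ∘ flip trans (sym v≡x)) v′≢x y′v′)))
      ... | no  v≢x  | yes v′≡x = ⊥-elim (y≢y′ (farPairUnique-target E c farPair⁻
                                    (dist⁻ (RainbowDistIn-suc⇒≢ E c yv′ ∘ flip trans (sym v′≡x)) v≢x yv)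
                                    (dist⁻ (RainbowDistIn-suc⇒≢ E c y′v′ ∘ flip trans (sym v′≡x)) v≢x y′v)))
      ... | no  v≢x  | no  v′≢x with y Fin.≟ x | y′ Fin.≟ x
      ...   | yes y≡x | yes y′≡x = ⊥-elim (y≢y′ (trans y≡x (sym y′≡x)))
      ...   | yes _   | no  y′≢x = farPairUnique-source E c farPair⁻ (dist⁻ y′≢x v≢x y′v) (dist⁻ y′≢x v′≢x y′v′)
      ...   | no  y≢x | yes _    = farPairUnique-source E c farPair⁻ (dist⁻ y≢x v≢x yv) (dist⁻ y≢x v′≢x yv′)
      ...   | no  y≢x | no  y′≢x =
        ⊥-elim (y≢y′ (farPairUnique-target E c farPair⁻ (dist⁻ y≢x v≢x yv) (dist⁻ y′≢x v≢x y′v)))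

    module _ {t} (diameter⁻ : RainbowDiameter≤ E c A⁻ (suc t)) where

      far-through-x : ∀ {u v} → RainbowDistIn E c A u v (suc (suc t)) → u ≡ x ⊎ v ≡ x
      far-through-x {u} {v} dist with u Fin.≟ x | v Fin.≟ x
      ... | yes u≡x | _       = inj₁ u≡x
      ... | no  _   | yes v≡x = inj₂ v≡x
      ... | no  u≢x | no  v≢x =
        let u∈A , v∈A = RainbowDistIn-endpoints E c dist
            d , dist′ , d≤ = diameter⁻ (∈-remove⁺ u∈A u≢x) (∈-remove⁺ v∈A v≢x)
        in ⊥-elim (ℕ.<-irrefl refl (subst (_≤ suc t) (RainbowDistIn-functional E c dist′ (dist⁻ u≢x v≢x dist)) d≤))

      far-from-x : ∀ {v} → RainbowDistIn E c A x v (suc (suc t)) →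
                   RainbowDistIn E c A⁻ y₁ v (suc t) × RainbowDistIn E c A⁻ y₂ v (suc t)
      far-from-x {v} dist =
        let v≢x = RainbowDistIn-suc⇒≢ E c dist ∘ sym
            v∈A = proj₂ (RainbowDistIn-endpoints E c dist)
            d₁ , d₂ , dist₁ , dist₂ , d₁≤ , d₂≤ = neighbour-dists diameter⁻ v∈A v≢x
            d₁⊓d₂≡ = ℕ.suc-injective (RainbowDistIn-functional E c (dist-from-x v≢x dist₁ dist₂) dist)
            d₁≡ , d₂≡ = ⊓≡-both d₁≤ d₂≤ d₁⊓d₂≡
        in subst (RainbowDistIn E c A⁻ y₁ v) d₁≡ dist₁ , subst (RainbowDistIn E c A⁻ y₂ v) d₂≡ dist₂

      far-anchored : ∀ {u v} → RainbowDistIn E c A u v (suc (suc t)) →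
                     ∃ λ r → RainbowDistIn E c A x r (suc (suc t)) × SamePair u v x r
      far-anchored {u} {v} dist with far-through-x dist
      ... | inj₁ refl = v , dist , inj₁ (refl , refl)
      ... | inj₂ refl = u , RainbowDistIn-sym E c dist , inj₂ (refl , refl)

    even-step : ∀ {t} → RainbowDiameter≤ E c A⁻ (suc t) → CommonFarVertexUnique E c A⁻ (suc t) →
                RainbowDiameter≤ E c A (suc (suc t)) × FarPairUnique E c A (suc (suc t))
    even-step {t} diameter⁻ commonFar⁻ = diameter (ℕ.n≤1+n _) from-x diameter⁻ , farPair
      where
      from-x : ∀ {v} → v ∈ A → v ≢ x → ∃ λ d → RainbowDistIn E c A x v d × d ≤ suc (suc t)
      from-x v∈A v≢x = let d₁ , d₂ , dist₁ , dist₂ , d₁≤ , _ = neighbour-dists diameter⁻ v∈A v≢x in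
        suc (d₁ ⊓ d₂) , dist-from-x v≢x dist₁ dist₂ , s≤s (ℕ.≤-trans (ℕ.m⊓n≤m d₁ d₂) d₁≤)

      farPair : FarPairUnique E c A (suc (suc t))
      farPair dist dist′ with far-anchored diameter⁻ dist | far-anchored diameter⁻ dist′
      ... | r , xr , uv~xr | r′ , xr′ , u′v′~xr′ with far-from-x diameter⁻ xr | far-from-x diameter⁻ xr′
      ...   | y₁r , y₂r | y₁r′ , y₂r′ with commonFar⁻ y₁≢y₂ y₁r y₂r y₁r′ y₂r′
      ...     | refl = samePair-trans uv~xr (samePair-sym u′v′~xr′)

  private
    module _ {A : List (Fin (suc K))} (admissible : Admissible A) (size : length A ≡ 2) where

      open Admissible admissible

      only-ends : ∀ {u} → u ∈ A → u ≡ a ⊎ u ≡ b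
      only-ends {u} u∈A with classify u
      ... | inj₁ u≡a          = inj₁ u≡a
      ... | inj₂ (inj₁ u≡b)   = inj₂ u≡b
      ... | inj₂ (inj₂ inner) = ⊥-elim (ℕ.<-irrefl (sym innerPart≡0) (∈-length (∈-innerPart⁺ admissible u∈A inner)))
        where
        innerPart≡0 : length (innerPart A) ≡ 0
        innerPart≡0 = ℕ.+-cancelˡ-≡ 2 _ _ (trans (sym (length-innerPart admissible)) size)

      ends-pair : ∀ {u v} → u ∈ A → v ∈ A → u ≢ v → SamePair u v a b
      ends-pair u∈A v∈A u≢v with only-ends u∈A | only-ends v∈A
      ... | inj₁ u≡a | inj₁ v≡a = ⊥-elim (u≢v (trans u≡a (sym v≡a)))
      ... | inj₁ u≡a | inj₂ v≡b = inj₁ (u≡a , v≡b)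
      ... | inj₂ u≡b | inj₁ v≡a = inj₂ (u≡b , v≡a)
      ... | inj₂ u≡b | inj₂ v≡b = ⊥-elim (u≢v (trans u≡b (sym v≡b)))

      base-diameter : RainbowDiameter≤ E c A 1
      base-diameter {u} {v} u∈A v∈A with u Fin.≟ v
      ... | yes refl = 0 , RainbowDistIn-refl E c u∈A , z≤n
      ... | no  u≢v with ends-pair u∈A v∈A u≢v
      ...   | inj₁ (refl , refl) = 1 , RainbowDistIn-edge E c (inj₁ refl) u≢v u∈A v∈A , ℕ.≤-refl
      ...   | inj₂ (refl , refl) = 1 , RainbowDistIn-edge E c (inj₂ refl) u≢v u∈A v∈A , ℕ.≤-refl

      base-farPair : FarPairUnique E c A 1
      base-farPair dist dist′ = samePair-trans (ends-pair′ dist) (samePair-sym (ends-pair′ dist′))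
        where
        ends-pair′ : ∀ {u v} → RainbowDistIn E c A u v 1 → SamePair u v a b
        ends-pair′ dist = let u∈A , v∈A = RainbowDistIn-endpoints E c dist in
                          ends-pair u∈A v∈A (RainbowDistIn-suc⇒≢ E c dist)

  even-case : ∀ t {A} → Admissible A → length A ≡ 2 + t * 2 →
              RainbowDiameter≤ E c A (suc t) × FarPairUnique E c A (suc t)
  odd-case  : ∀ t {A} → Admissible A → length A ≡ 3 + t * 2 →
              RainbowDiameter≤ E c A (suc t) × CommonFarVertexUnique E c A (suc t)

  even-case zero    admissible size = base-diameter admissible size , base-farPair admissible size
  even-case (suc t) admissible size with removable-exists admissible (subst (3 ≤_) (sym size) (s≤s (s≤s (s≤s z≤n))))
  ... | _ , removable = uncurry even-step (odd-case t admissible⁻ (ℕ.suc-injective (trans (sym length-A⁻) size)))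
    where open Removal admissible removable

  odd-case t admissible size with removable-exists admissible (subst (3 ≤_) (sym size) (s≤s (s≤s (s≤s z≤n))))
  ... | _ , removable = uncurry odd-step (even-case t admissible⁻ (ℕ.suc-injective (trans (sym length-A⁻) size)))
    where open Removal admissible removable

  admissible-allFin : Admissible (allFin (suc K))
  admissible-allFin = record
    { unique = allFin⁺ (suc K) ; a∈A = ∈-allFin a ; b∈A = ∈-allFin b ; closed = λ _ _ _ _ → ∈-allFin _ }

parity : ∀ k → ∃ λ t → k ≡ t * 2 ⊎ k ≡ suc (t * 2)
parity zero    = 0 , inj₁ refl
parity (suc k) with parity k
... | t , inj₁ k≡2t   = t , inj₂ (cong suc k≡2t)
... | t , inj₂ k≡1+2t = suc t , inj₁ (cong suc k≡1+2t)

[r+t*2]/2≡r/2+t : ∀ r t → (r + t * 2) / 2 ≡ r / 2 + t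
[r+t*2]/2≡r/2+t r t = trans (+-distrib-/-∣ʳ r (divides t refl)) (cong (r / 2 +_) (m*n/n≡m t 2))

2∤1+t*2 : ∀ t → ¬ 2 ∣ 1 + t * 2
2∤1+t*2 t 2∣ with trans (sym ([m+kn]%n≡m%n 1 t 2)) (n∣m⇒m%n≡0 _ 2 2∣)
... | ()

rainbowDiameter : ∀ {K m} {E : Fin m → Fin (suc K) × Fin (suc K)} {c : Fin m → Fin K} →
                  Simple E → ¬ HasRainbowCycle E c →
                  ∀ {z} → SingletonClass E c z → (∀ i → i ≢ z → PairClass E c i) →
                  (∀ u v → u ≢ v → Σ ℕ λ d → RainbowDist E c u v d × d ≤ suc K / 2)
                  × (2 ∣ suc K → ∀ u v u′ v′ → RainbowDist E c u v (suc K / 2) → RainbowDist E c u′ v′ (suc K / 2) →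
                     SamePair u v u′ v′)
rainbowDiameter {suc K} {E = E} {c} simple rainbowCycleFree singleton pairs with parity K
... | t , inj₁ refl rewrite [r+t*2]/2≡r/2+t 2 t =
  let diameter , farPair = even-case t admissible-allFin (length-tabulate id)
  in RainbowDiameter≤-allFin E c diameter , λ _ → FarPairUnique-allFin E c farPair
  where open Pruning simple rainbowCycleFree singleton pairs
... | t , inj₂ refl rewrite [r+t*2]/2≡r/2+t 3 t =
  RainbowDiameter≤-allFin E c (proj₁ (odd-case t admissible-allFin (length-tabulate id))) ,
  λ 2∣n → ⊥-elim (2∤1+t*2 (suc t) 2∣n)
  where open Pruning simple rainbowCycleFree singleton pairs

lemma3 : (n : ℕ) → 3 ≤ n →
    (E : Fin (2 * n ∸ 3) → Fin n × Fin n) →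
    (c : Fin (2 * n ∸ 3) → Fin (n ∸ 1)) →
    Simple E → Connected E →
    (∀ i → (toℕ i ≡ 0 → classSize E c i ≡ 1) × (toℕ i ≢ 0 → classSize E c i ≡ 2)) →
    ¬ HasRainbowCycle E c →
    (∀ u v → u ≢ v → Σ ℕ λ d → RainbowDist E c u v d × d ≤ n / 2)
    × (2 ∣ n → ∀ u v u′ v′ → RainbowDist E c u v (n / 2) → RainbowDist E c u′ v′ (n / 2) →
        (u ≡ u′ × v ≡ v′) ⊎ (u ≡ v′ × v ≡ u′))
lemma3 _ (s≤s (s≤s (s≤s _))) E c simple _ classSizes rainbowCycleFree =
  rainbowDiameter simple rainbowCycleFree singleton pairs
  where
  singleton : SingletonClass E c zero
  singleton = classSize≡1⇒singleton E c zero (proj₁ (classSizes zero) refl)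
  pairs : ∀ i → i ≢ zero → PairClass E c i
  pairs i i≢0 = classSize≡2⇒pair E c i (proj₂ (classSizes i) (i≢0 ∘ toℕ-injective))
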